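{- Let $\mathbf{A}$ be an $\mathbb{RL}^D$-algebra whose lattice reduct is complete. Then for every $a\in A$ the greatest element $b\le a$ with $b\vee\neg b=1$ exists and equals $\bigwedge\{(\neg D)^n a: n\in\mathbb{N}\}$, where $(\neg D)^0a=a$ and $(\neg D)^{k+1}a=\neg D((\neg D)^k a)$.
   Context: A residuated lattice is an algebra $(A;\wedge,\vee,\cdot,\to,0,1)$ with $(A;\wedge,\vee,0,1)$ a bounded lattice ($0$ least, $1$ greatest), $(A;\cdot,1)$ a commutative monoid, and $a\cdot b\le c$ iff $a\le b\to c$; $\neg a=a\to0$. An $\mathbb{RL}^D$-algebra is a residuated lattice expanded with a unary operation $D$ such that, for every $a$, $Da$ is the least element $b$ with $a\vee b=1$. $\mathbb{N}$ includes $0$. -}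

module Defs where

open import Data.Nat using (ℕ; zero; suc)
open import Data.Product using (Σ; _×_; ∃)
open import Relation.Binary.PropositionalEquality using (_≡_)

record RLD : Set₁ where
  infixr 7 _∧_
  infixr 6 _∨_
  infixr 8 _·_
  infixr 5 _⇒_
  field
    Carrier : Set
    _∧_ _∨_ _·_ _⇒_ : Carrier → Carrier → Carrier
    𝟘 𝟙 : Carrier
    D : Carrier → Carrier
    ∧-comm  : ∀ x y → x ∧ y ≡ y ∧ x
    ∨-comm  : ∀ x y → x ∨ y ≡ y ∨ x
    ∧-assoc : ∀ x y z → (x ∧ y) ∧ z ≡ x ∧ (y ∧ z)
    ∨-assoc : ∀ x y z → (x ∨ y) ∨ z ≡ x ∨ (y ∨ z)
    ∧-absorbs-∨ : ∀ x y → x ∧ (x ∨ y) ≡ x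
    ∨-absorbs-∧ : ∀ x y → x ∨ (x ∧ y) ≡ x
    𝟘-least    : ∀ x → 𝟘 ∧ x ≡ 𝟘
    𝟙-greatest : ∀ x → x ∧ 𝟙 ≡ x
    ·-comm  : ∀ x y → x · y ≡ y · x
    ·-assoc : ∀ x y z → (x · y) · z ≡ x · (y · z)
    ·-identity : ∀ x → x · 𝟙 ≡ x
    -- residuation: x·y ≤ z iff x ≤ y → z   (order: u ≤ v iff u ∧ v ≡ u)
    residuation₁ : ∀ x y z → (x · y) ∧ z ≡ x · y → x ∧ (y ⇒ z) ≡ x
    residuation₂ : ∀ x y z → x ∧ (y ⇒ z) ≡ x → (x · y) ∧ z ≡ x · y
    D-join  : ∀ x → x ∨ D x ≡ 𝟙
    D-least : ∀ x y → x ∨ y ≡ 𝟙 → D x ∧ y ≡ D x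

  _≤_ : Carrier → Carrier → Set
  x ≤ y = x ∧ y ≡ x

  ¬_ : Carrier → Carrier
  ¬ x = x ⇒ 𝟘

  ¬D^ : ℕ → Carrier → Carrier
  ¬D^ zero    a = a
  ¬D^ (suc n) a = ¬ (D (¬D^ n a))

  IsInf : (Carrier → Set) → Carrier → Set
  IsInf S m = (∀ x → S x → m ≤ x) × (∀ y → (∀ x → S x → y ≤ x) → y ≤ m)

  IsGreatest : (Carrier → Set) → Carrier → Set
  IsGreatest S m = S m × (∀ x → S x → x ≤ m)

Complete : RLD → Set₁
Complete 𝐀 = ∀ (S : Carrier → Set) → Σ Carrier (IsInf S)
  where open RLD 𝐀

-- Let b be the infimum of the orbit a, ¬D a, ¬D¬D a, … .  Every complemented x ≤ c
-- satisfies c ∨ ¬x = 1, hence D c ≤ ¬x and x ≤ ¬D c; so a complemented x ≤ a lies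
-- below the whole orbit and therefore below b.  Conversely b ≤ ¬D c gives D ¬b ≤ c for
-- every c in the orbit, so D ¬b ≤ b, i.e. ¬b ∨ b = 1: the infimum is itself complemented.
module Submission where

open import Defs
open import Data.Nat using (ℕ; zero; suc)
open import Data.Product using (Σ; _×_; ∃; _,_; proj₁; proj₂)
open import Relation.Binary.PropositionalEquality using (_≡_; refl; sym; trans; cong; subst; module ≡-Reasoning)
open ≡-Reasoning

module RLDProperties (𝐀 : RLD) where
  open RLD 𝐀

  ≤-trans : ∀ {x y z} → x ≤ y → y ≤ z → x ≤ z
  ≤-trans {x} {y} {z} x≤y y≤z = begin
    x ∧ z        ≡⟨ cong (_∧ z) (sym x≤y) ⟩
    (x ∧ y) ∧ z  ≡⟨ ∧-assoc x y z ⟩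
    x ∧ (y ∧ z)  ≡⟨ cong (x ∧_) y≤z ⟩
    x ∧ y        ≡⟨ x≤y ⟩
    x            ∎

  x≤y⇒x∨y≡y : ∀ {x y} → x ≤ y → x ∨ y ≡ y
  x≤y⇒x∨y≡y {x} {y} x≤y = begin
    x ∨ y        ≡⟨ cong (_∨ y) (trans (sym x≤y) (∧-comm x y)) ⟩
    (y ∧ x) ∨ y  ≡⟨ ∨-comm (y ∧ x) y ⟩
    y ∨ (y ∧ x)  ≡⟨ ∨-absorbs-∧ y x ⟩
    y            ∎

  ∨-zeroˡ : ∀ x → 𝟙 ∨ x ≡ 𝟙
  ∨-zeroˡ x = begin
    𝟙 ∨ x        ≡⟨ cong (𝟙 ∨_) (sym (trans (∧-comm 𝟙 x) (𝟙-greatest x))) ⟩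
    𝟙 ∨ (𝟙 ∧ x)  ≡⟨ ∨-absorbs-∧ 𝟙 x ⟩
    𝟙            ∎

  ∨-zeroʳ : ∀ x → x ∨ 𝟙 ≡ 𝟙
  ∨-zeroʳ x = trans (∨-comm x 𝟙) (∨-zeroˡ x)

  D≤⇒∨≡𝟙 : ∀ {x y} → D x ≤ y → x ∨ y ≡ 𝟙
  D≤⇒∨≡𝟙 {x} {y} Dx≤y = begin
    x ∨ y          ≡⟨ cong (x ∨_) (sym (x≤y⇒x∨y≡y Dx≤y)) ⟩
    x ∨ (D x ∨ y)  ≡⟨ sym (∨-assoc x (D x) y) ⟩
    (x ∨ D x) ∨ y  ≡⟨ cong (_∨ y) (D-join x) ⟩
    𝟙 ∨ y          ≡⟨ ∨-zeroˡ y ⟩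
    𝟙              ∎

  D-swap : ∀ {x y} → D x ≤ y → D y ≤ x
  D-swap {x} {y} Dx≤y = D-least y x (trans (∨-comm y x) (D≤⇒∨≡𝟙 Dx≤y))

  ¬-swap : ∀ {x y} → x ≤ (¬ y) → y ≤ (¬ x)
  ¬-swap {x} {y} x≤¬y =
    residuation₁ y x 𝟘 (subst (λ t → t ∧ 𝟘 ≡ t) (·-comm x y) (residuation₂ x y 𝟘 x≤¬y))

  Complemented : Carrier → Set
  Complemented x = x ∨ ¬ x ≡ 𝟙

  complemented-≤⇒≤¬D : ∀ {x c} → Complemented x → x ≤ c → x ≤ (¬ D c)
  complemented-≤⇒≤¬D {x} {c} x∨¬x≡𝟙 x≤c = ¬-swap (D-least c (¬ x) c∨¬x≡𝟙)
    where
    c∨¬x≡𝟙 : c ∨ ¬ x ≡ 𝟙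
    c∨¬x≡𝟙 = begin
      c ∨ ¬ x        ≡⟨ cong (_∨ ¬ x) (sym (trans (∨-comm c x) (x≤y⇒x∨y≡y x≤c))) ⟩
      (c ∨ x) ∨ ¬ x  ≡⟨ ∨-assoc c x (¬ x) ⟩
      c ∨ (x ∨ ¬ x)  ≡⟨ cong (c ∨_) x∨¬x≡𝟙 ⟩
      c ∨ 𝟙          ≡⟨ ∨-zeroʳ c ⟩
      𝟙              ∎

  complemented-≤⇒≤¬D^ : ∀ {x a} → Complemented x → x ≤ a → ∀ n → x ≤ ¬D^ n a
  complemented-≤⇒≤¬D^ cx x≤a zero    = x≤a
  complemented-≤⇒≤¬D^ cx x≤a (suc n) = complemented-≤⇒≤¬D cx (complemented-≤⇒≤¬D^ cx x≤a n)

  inf-¬D-closed⇒complemented : ∀ {S b} → (∀ x → S x → S (¬ D x)) → IsInf S b → Complemented b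
  inf-¬D-closed⇒complemented {S} {b} closed (b-lower , b-greatest) =
    trans (∨-comm b (¬ b)) (D≤⇒∨≡𝟙 D¬b≤b)
    where
    D¬b≤b : D (¬ b) ≤ b
    D¬b≤b = b-greatest (D (¬ b)) λ x Sx → D-swap (¬-swap (b-lower (¬ D x) (closed x Sx)))

  Orbit : Carrier → Carrier → Set
  Orbit a x = ∃ λ (n : ℕ) → x ≡ ¬D^ n a

  orbit-¬D-closed : ∀ a x → Orbit a x → Orbit a (¬ D x)
  orbit-¬D-closed a x (n , refl) = suc n , refl

proposition22 : (𝐀 : RLD) → Complete 𝐀 → (a : RLD.Carrier 𝐀) →
    Σ (RLD.Carrier 𝐀) λ b →
    RLD.IsGreatest 𝐀 (λ x → RLD._≤_ 𝐀 x a × RLD._∨_ 𝐀 x (RLD.¬_ 𝐀 x) ≡ RLD.𝟙 𝐀) b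
    × RLD.IsInf 𝐀 (λ x → ∃ λ (n : ℕ) → x ≡ RLD.¬D^ 𝐀 n a) b
proposition22 𝐀 complete a = b , ((b≤a , complemented-b) , b-greatest) , b-inf
  where
  open RLD 𝐀
  open RLDProperties 𝐀

  b : Carrier
  b = proj₁ (complete (Orbit a))

  b-inf : IsInf (Orbit a) b
  b-inf = proj₂ (complete (Orbit a))

  b≤a : b ≤ a
  b≤a = proj₁ b-inf a (zero , refl)

  complemented-b : Complemented b
  complemented-b = inf-¬D-closed⇒complemented (orbit-¬D-closed a) b-inf

  b-greatest : ∀ x → x ≤ a × Complemented x → x ≤ b
  b-greatest x (x≤a , cx) =
    proj₂ b-inf x λ { _ (n , refl) → complemented-≤⇒≤¬D^ cx x≤a n }
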